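{- For every agent $a\in A$, every resource $s\in Res$ and every formula $\phi$, the formulas $E_a^s\phi$ and $C_a^s(\widehat{D}_a^s\phi)$ are semantically equivalent: in every ERL model $\mathcal M=((R,\bullet),\{\sim_a\}_{a\in A},V)$ and for every $r\in R$, $r\models E_a^s\phi$ iff $r\models C_a^s(\widehat{D}_a^s\phi)$.
   Context: Fix a finite set $A$ of agents, a finite set $Res$ of resources containing a distinguished element $e$ and equipped with a partial binary operation $\cdot$, and a countable set $\mathrm{Prop}$ of propositional atoms. Formulas: $\phi ::= p \mid \bot \mid \top \mid \neg\phi \mid I \mid \phi\vee\phi \mid \phi\wedge\phi \mid \phi\to\phi \mid \phi*\phi \mid \phi\mathbin{ -\!*}\phi \mid C_a^s\phi \mid D_a^s\phi \mid E_a^s\phi$, with $p\in\mathrm{Prop}$, $a\in A$, $s\in Res$. A partial resource monoid is a pair $(R,\bullet)$ with $Res\subseteq R$ and $\bullet:R\times R\rightharpoonup R$ partial such that for all $r_1,r_2,r_3\in R$: (i) if $r_1,r_2,r_3\in Res$ then $r_1=r_2\cdot r_3$ iff $r_1=r_2\bullet r_3$; (ii) $r_1\bullet e$ is defined and equals $r_1$; (iii) if $r_1\bullet r_2$ is defined then $r_2\bullet r_1$ is defined and equal to it; (iv) if $r_1\bullet(r_2\bullet r_3)$ is defined then $(r_1\bullet r_2)\bullet r_3$ is defined and equal to it. A model is $\mathcal M=((R,\bullet),\{\sim_a\}_{a\in A},V)$ with each $\sim_a$ an equivalence relation on $R$ and $V:\mathrm{Prop}\to\wp(R)$. Satisfaction: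 atoms via $V$; $\bot$ never, $\top$ always; $\neg,\vee,\wedge,\to$ classical; $r\models I$ iff $r=e$; $r\models\phi*\psi$ iff there are $r_1,r_2$ with $r_1\bullet r_2$ defined, $r_1\bullet r_2=r$, $r_1\models\phi$, $r_2\models\psi$; $r\models\phi\mathbin{ -\!*}\psi$ iff for all $r'$, if $r\bullet r'$ is defined and $r'\models\phi$ then $r\bullet r'\models\psi$; $r\models C_a^s\phi$ iff, if $r\bullet s$ is defined, then for all $r'$ with $r\bullet s\sim_a r'$, $r'\models\phi$; $r\models D_a^s\phi$ iff there is $r'$ with $r'\bullet s$ defined, $r\sim_a r'\bullet s$ and $r'\bullet s\models\phi$; $r\models E_a^s\phi$ iff, if $r\bullet s$ is defined, then for all $r'\in R$ with $r'\bullet s$ defined and $r\bullet s\sim_a r'\bullet s$, $r'\bullet s\models\phi$. Abbreviation: $\widehat{D}_a^s\phi:=\neg D_a^s\neg\phi$. -}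

module Defs where

open import Data.Nat using (ℕ)
open import Data.Fin using (Fin)
open import Data.Maybe using (Maybe; just; nothing)
open import Data.Product using (Σ; _×_; _,_)
open import Data.Sum using (_⊎_)
open import Data.Empty using (⊥)
open import Data.Unit using (⊤)
open import Relation.Nullary using (¬_)
open import Relation.Binary.PropositionalEquality using (_≡_)
open import Relation.Binary.Structures using (IsEquivalence)

Atom : Set
Atom = ℕ

record Signature : Set where
  field
    nA   : ℕ
    nRes : ℕ
    e    : Fin nRes
    _·_  : Fin nRes → Fin nRes → Maybe (Fin nRes)

  Agent : Set
  Agent = Fin nA

  Res : Set
  Res = Fin nRes

module ERL (Sig : Signature) where
  open Signature Sig public

  data Formula : Set where
    atom  : Atom → Formula
    ⊥f ⊤f : Formula
    ¬f    : Formula → Formula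
    If    : Formula
    _∨f_ _∧f_ _⇒f_ _*f_ _-*f_ : Formula → Formula → Formula
    C D E : Agent → Res → Formula → Formula

  Dhat : Agent → Res → Formula → Formula
  Dhat a s φ = ¬f (D a s (¬f φ))

  -- Partial resource monoid (R, •): Res ⊆ R via an injection ι,
  -- • : R × R ⇀ R modelled as R → R → Maybe R (nothing = undefined).
  record PRM : Set₁ where
    field
      R     : Set
      ι     : Res → R
      ι-inj : ∀ {x y} → ι x ≡ ι y → x ≡ y
      _•_   : R → R → Maybe R
      agree₁ : ∀ (r₁ r₂ r₃ : Res) → r₂ · r₃ ≡ just r₁ → ι r₂ • ι r₃ ≡ just (ι r₁)
      agree₂ : ∀ (r₁ r₂ r₃ : Res) → ι r₂ • ι r₃ ≡ just (ι r₁) → r₂ · r₃ ≡ just r₁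
      unit  : ∀ r → r • ι e ≡ just r
      comm  : ∀ r₁ r₂ r → r₁ • r₂ ≡ just r → r₂ • r₁ ≡ just r
      assoc : ∀ r₁ r₂ r₃ r₂₃ r → r₂ • r₃ ≡ just r₂₃ → r₁ • r₂₃ ≡ just r →
              Σ R λ r₁₂ → (r₁ • r₂ ≡ just r₁₂) × (r₁₂ • r₃ ≡ just r)

  record Model : Set₁ where
    field
      monoid : PRM
    open PRM monoid public
    field
      _∼[_]_ : R → Agent → R → Set
      ∼-equiv : ∀ a → IsEquivalence (λ x y → x ∼[ a ] y)
      V : Atom → R → Set

  module Sat (M : Model) where
    open Model M

    _⊨_ : R → Formula → Set
    r ⊨ atom p   = V p r
    r ⊨ ⊥f       = ⊥
    r ⊨ ⊤f       = ⊤
    r ⊨ ¬f φ     = ¬ (r ⊨ φ)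
    r ⊨ If       = r ≡ ι e
    r ⊨ (φ ∨f ψ) = (r ⊨ φ) ⊎ (r ⊨ ψ)
    r ⊨ (φ ∧f ψ) = (r ⊨ φ) × (r ⊨ ψ)
    r ⊨ (φ ⇒f ψ) = (r ⊨ φ) → (r ⊨ ψ)
    r ⊨ (φ *f ψ) = Σ R λ r₁ → Σ R λ r₂ → (r₁ • r₂ ≡ just r) × (r₁ ⊨ φ) × (r₂ ⊨ ψ)
    r ⊨ (φ -*f ψ) = ∀ r' t → r • r' ≡ just t → r' ⊨ φ → t ⊨ ψ
    r ⊨ C a s φ  = ∀ t → r • ι s ≡ just t → ∀ r' → t ∼[ a ] r' → r' ⊨ φ
    r ⊨ D a s φ  = Σ R λ r' → Σ R λ t → (r' • ι s ≡ just t) × (r ∼[ a ] t) × (t ⊨ φ)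
    r ⊨ E a s φ  = ∀ t → r • ι s ≡ just t → ∀ r' t' → r' • ι s ≡ just t' →
                   t ∼[ a ] t' → t' ⊨ φ

module Submission where

-- Unfolding the semantics, both sides speak about the states t = r • s and
-- the s-extended states t' = r' • s that are a-indistinguishable from t.
-- E_a^s φ says every such t' satisfies φ; C_a^s (D̂_a^s φ) says every state
-- u ∼_a t has no s-extended a-neighbour refuting φ.
--   * E ⇒ C D̂ is constructive: a refuting neighbour t' of some u ∼_a t is,
--     by transitivity of ∼_a, itself a neighbour of t, so E applies to it.
--   * C D̂ ⇒ E instantiates u := t' (reflexivity of ∼_a), which shows that
--     t' ⊨ φ cannot fail; turning that into t' ⊨ φ needs double-negation
--     elimination, supplied here by the classical decision oracle of the
--     statement.

open import Defs
open import Relation.Nullary using (Dec; ¬_)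
open import Relation.Nullary.Decidable using (decidable-stable)
open import Data.Product using (_×_; _,_)
open import Relation.Binary.Structures using (IsEquivalence)

module EpistemicEquivalence {Sig : Signature} (M : ERL.Model Sig)
  (a : ERL.Agent Sig) (s : ERL.Res Sig) (φ : ERL.Formula Sig) where
  open ERL Sig
  open Model M
  open Sat M
  open IsEquivalence (∼-equiv a) using (refl; trans)

  E⇒CD̂ : ∀ r → r ⊨ E a s φ → r ⊨ C a s (Dhat a s φ)
  E⇒CD̂ r hE t r•s≡t u t∼u (r' , t' , r'•s≡t' , u∼t' , t'⊭φ) =
    t'⊭φ (hE t r•s≡t r' t' r'•s≡t' (trans t∼u u∼t'))

  -- Conversely C_a^s D̂_a^s φ implies E_a^s φ, provided satisfaction of φ is
  -- stable under double negation (reflexivity of ∼_a picks u := t').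
  CD̂⇒E : (∀ t → ¬ ¬ (t ⊨ φ) → t ⊨ φ) →
         ∀ r → r ⊨ C a s (Dhat a s φ) → r ⊨ E a s φ
  CD̂⇒E stable r hC t r•s≡t r' t' r'•s≡t' t∼t' =
    stable t' λ t'⊭φ → hC t r•s≡t t' t∼t' (r' , t' , r'•s≡t' , refl , t'⊭φ)

proposition3 : (Sig : Signature) → (let open ERL Sig) →
    (∀ (P : Set) → Dec P) →
    (M : Model) → (let open Model M) → (let open Sat M) →
    ∀ (a : Agent) (s : Res) (φ : Formula) (r : R) →
    ((r ⊨ E a s φ) → (r ⊨ C a s (Dhat a s φ))) × ((r ⊨ C a s (Dhat a s φ)) → (r ⊨ E a s φ))
proposition3 Sig decide M a s φ r =
  E⇒CD̂ r , CD̂⇒E (λ t → decidable-stable (decide _)) r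
  where open EpistemicEquivalence M a s φ
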